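{- Let $\Gamma$ be a numerical semigroup with embedding dimension $e(\Gamma)\ge4$. If there exists a gap $g\in\mathbb{N}\setminus\Gamma$ with $W(g)\ge0$, then $W_\Gamma(k)\ge0$ for every $k\ge4$. In particular, $c(\Gamma)\le e(\Gamma)\,\delta(\Gamma)$.
   Context: A numerical semigroup is an additive submonoid $\Gamma\subseteq\mathbb{N}$ with finite complement; its elements not in $\Gamma$ are gaps, and $e(\Gamma)$ is the cardinality of its minimal generating set. For $\Delta\subseteq\mathbb{N}$ with finite complement, $c(\Delta)$ is one more than the largest element of $\mathbb{N}\setminus\Delta$ and $\delta(\Delta)=|\{x\in\Delta:x<c(\Delta)\}|$. $W_\Gamma(k)=k\delta(\Gamma)-c(\Gamma)$. For a gap $g$, let $\Delta_g=\Gamma\cup(g+\Gamma)$ and $W(g)=2\delta(\Delta_g)-c(\Delta_g)$. -}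

module Defs where

open import Data.Bool using (Bool; true; false; T; if_then_else_; _∨_)
open import Data.Nat using (ℕ; zero; suc; _+_; _*_; _∸_; _≤_; _≤ᵇ_)
open import Data.Integer as ℤ using (ℤ; +_)
open import Data.List using (List; length; filter; upTo)
open import Data.List.Membership.Propositional using (_∈_)
open import Data.List.Relation.Unary.Unique.Propositional using (Unique)
open import Data.Product using (Σ; ∃; _×_)
open import Relation.Nullary using (¬_)
open import Relation.Nullary.Decidable using (T?)
open import Relation.Binary.PropositionalEquality using (_≡_; _≢_)
open import Function.Bundles using (_⇔_)

record NumericalSemigroup : Set where
  field
    mem      : ℕ → Bool
    zero∈    : T (mem 0)
    closed   : ∀ a b → T (mem a) → T (mem b) → T (mem (a + b))
    bound    : ℕ
    cofinite : ∀ n → bound ≤ n → T (mem n)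

open NumericalSemigroup public

_∈Γ_ : ℕ → NumericalSemigroup → Set
x ∈Γ Γ = T (mem Γ x)

-- For a Boolean predicate p with all n ≥ N in p:
-- one more than the largest element below N not in p (0 if none).
condBelow : (ℕ → Bool) → ℕ → ℕ
condBelow p zero    = zero
condBelow p (suc n) = if p n then condBelow p n else suc n

countBelow : (ℕ → Bool) → ℕ → ℕ
countBelow p c = length (filter (λ x → T? (p x)) (upTo c))

cΓ : NumericalSemigroup → ℕ
cΓ Γ = condBelow (mem Γ) (bound Γ)

δΓ : NumericalSemigroup → ℕ
δΓ Γ = countBelow (mem Γ) (cΓ Γ)

MinGen : NumericalSemigroup → ℕ → Set
MinGen Γ x = x ∈Γ Γ × x ≢ 0 ×
  ¬ (Σ ℕ λ a → Σ ℕ λ b → a ∈Γ Γ × b ∈Γ Γ × a ≢ 0 × b ≢ 0 × a + b ≡ x)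

HasEmbDim : NumericalSemigroup → ℕ → Set
HasEmbDim Γ e = Σ (List ℕ) λ L →
  Unique L × (∀ x → (x ∈ L) ⇔ MinGen Γ x) × length L ≡ e

WΓ : NumericalSemigroup → ℕ → ℤ
WΓ Γ k = + (k * δΓ Γ) ℤ.- + cΓ Γ

memΔ : NumericalSemigroup → ℕ → ℕ → Bool
memΔ Γ g x = mem Γ x ∨ ((g ≤ᵇ x) Data.Bool.∧ mem Γ (x ∸ g))

-- c(Δ_g), δ(Δ_g); Γ ⊆ Δ_g so bound Γ is a bound for Δ_g too
cΔ : NumericalSemigroup → ℕ → ℕ
cΔ Γ g = condBelow (memΔ Γ g) (bound Γ)

δΔ : NumericalSemigroup → ℕ → ℕ
δΔ Γ g = countBelow (memΔ Γ g) (cΔ Γ g)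

Wgap : NumericalSemigroup → ℕ → ℤ
Wgap Γ g = + (2 * δΔ Γ g) ℤ.- + cΔ Γ g

-- Since Γ ⊆ Δ_g, the conductor c' = c(Δ_g) is at most c = c(Γ), and every
-- x ∈ [c', c) lies in Δ_g.  Counting Δ_g below c therefore gives δ(Δ_g) + (c − c'),
-- while Δ_g = Γ ∪ (g + Γ) has at most 2δ(Γ) elements below c, as the translate
-- g + Γ has no more than Γ.  With c' ≤ 2δ(Δ_g), which is W(g) ≥ 0, this yields
-- c = c' + (c − c') ≤ 2(δ(Δ_g) + (c − c')) ≤ 4δ(Γ).
module Submission where

open import Defs
open import Data.Nat using (ℕ; _≤_; _*_)
open import Data.Integer as ℤ using (ℤ; +_)
open import Data.Product using (Σ; _×_)
open import Relation.Nullary using (¬_)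

open import Algebra.Properties.CommutativeSemigroup using (interchange)
open import Data.Bool using (Bool; true; false; T; _∨_; _∧_; if_then_else_)
open import Data.Bool.Properties using (T-∨)
open import Data.Empty using (⊥-elim)
open import Data.Integer.Properties using (drop‿+≤+; 0≤i-j⇒j≤i; i≤j⇒0≤j-i)
open import Data.List using (length; filter; upTo; _++_; [_])
open import Data.List.Properties using (upTo-∷ʳ; filter-++; length-++)
open import Data.Nat using (zero; suc; _+_; _∸_; _<_; _≤ᵇ_; z≤n)
open import Data.Nat.Properties
open import Data.Product using (_,_)
open import Data.Sum using (inj₁; inj₂)
open import Data.Unit using (tt)
open import Function.Bundles using (Equivalence)
open import Relation.Binary.PropositionalEquality
  using (_≡_; refl; sym; trans; cong; cong₂; subst; module ≡-Reasoning)
open import Relation.Nullary.Decidable using (T?)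

indicator : Bool → ℕ
indicator b = if b then 1 else 0

indicator-∨ : ∀ a b → indicator (a ∨ b) ≤ indicator a + indicator b
indicator-∨ true  b     = m≤m+n 1 (indicator b)
indicator-∨ false true  = ≤-refl
indicator-∨ false false = ≤-refl

-- memΔ Γ g is definitionally λ x → mem Γ x ∨ shiftBy g (mem Γ) x.
shiftBy : ℕ → (ℕ → Bool) → ℕ → Bool
shiftBy g p x = (g ≤ᵇ x) ∧ p (x ∸ g)

shiftBy-< : ∀ g p {x} → x < g → shiftBy g p x ≡ false
shiftBy-< g p {x} x<g with g ≤ᵇ x in g≤ᵇx
... | false = refl
... | true  = ⊥-elim (<⇒≱ x<g (≤ᵇ⇒≤ g x (subst T (sym g≤ᵇx) tt)))

shiftBy-+ : ∀ g p m → shiftBy g p (g + m) ≡ p m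
shiftBy-+ g p m with g ≤ᵇ g + m in g≤ᵇg+m
... | true  = cong p (m+n∸m≡n g m)
... | false = ⊥-elim (subst T g≤ᵇg+m (≤⇒≤ᵇ (m≤m+n g m)))

condBelow-≤ : ∀ p B → condBelow p B ≤ B
condBelow-≤ p zero    = z≤n
condBelow-≤ p (suc B) with p B
... | true  = m≤n⇒m≤1+n (condBelow-≤ p B)
... | false = ≤-refl

condBelow-antimono : ∀ {p q : ℕ → Bool} → (∀ x → T (p x) → T (q x)) →
                     ∀ B → condBelow q B ≤ condBelow p B
condBelow-antimono p⊆q zero = z≤n
condBelow-antimono {p} {q} p⊆q (suc B) with p B in pB | q B in qB
... | true  | true  = condBelow-antimono p⊆q B
... | true  | false = ⊥-elim (subst T qB (p⊆q B (subst T (sym pB) tt)))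
... | false | true  = m≤n⇒m≤1+n (condBelow-≤ q B)
... | false | false = ≤-refl

condBelow-≤⇒T : ∀ p B {x} → condBelow p B ≤ x → x < B → T (p x)
condBelow-≤⇒T p (suc B) {x} c≤x x<1+B with p B in pB | m≤n⇒m<n∨m≡n (≤-pred x<1+B)
... | true  | inj₁ x<B  = condBelow-≤⇒T p B c≤x x<B
... | true  | inj₂ refl = subst T (sym pB) tt
... | false | _         = ⊥-elim (<⇒≱ x<1+B c≤x)

length-filter-[_] : ∀ (p : ℕ → Bool) n → length (filter (λ x → T? (p x)) [ n ]) ≡ indicator (p n)
length-filter-[ p ] n with p n
... | true  = refl
... | false = refl

countBelow-suc : ∀ p n → countBelow p (suc n) ≡ countBelow p n + indicator (p n)
countBelow-suc p n = begin
  length (filter P (upTo (suc n)))              ≡⟨ cong (λ xs → length (filter P xs)) (sym (upTo-∷ʳ n)) ⟩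
  length (filter P (upTo n ++ [ n ]))           ≡⟨ cong length (filter-++ P (upTo n) [ n ]) ⟩
  length (filter P (upTo n) ++ filter P [ n ])  ≡⟨ length-++ (filter P (upTo n)) ⟩
  countBelow p n + length (filter P [ n ])      ≡⟨ cong (λ k → countBelow p n + k) (length-filter-[ p ] n) ⟩
  countBelow p n + indicator (p n)              ∎
  where
  open ≡-Reasoning
  P = λ x → T? (p x)

countBelow-mono : ∀ p {m n} → m ≤ n → countBelow p m ≤ countBelow p n
countBelow-mono p {m} {zero}  z≤n = ≤-refl
countBelow-mono p {m} {suc n} m≤1+n with m≤n⇒m<n∨m≡n m≤1+n
... | inj₂ refl  = ≤-refl
... | inj₁ m<1+n = begin
  countBelow p m                        ≤⟨ countBelow-mono p (≤-pred m<1+n) ⟩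
  countBelow p n                        ≤⟨ m≤m+n (countBelow p n) (indicator (p n)) ⟩
  countBelow p n + indicator (p n)      ≡⟨ countBelow-suc p n ⟨
  countBelow p (suc n)                  ∎
  where open ≤-Reasoning

countBelow-∨ : ∀ p q n → countBelow (λ x → p x ∨ q x) n ≤ countBelow p n + countBelow q n
countBelow-∨ p q zero    = z≤n
countBelow-∨ p q (suc n) = begin
  countBelow p∨q (suc n)                                          ≡⟨ countBelow-suc p∨q n ⟩
  countBelow p∨q n + indicator (p n ∨ q n)                        ≤⟨ +-mono-≤ (countBelow-∨ p q n) (indicator-∨ (p n) (q n)) ⟩
  (countBelow p n + countBelow q n) + (indicator (p n) + indicator (q n))
    ≡⟨ interchange +-commutativeSemigroup (countBelow p n) (countBelow q n) (indicator (p n)) (indicator (q n)) ⟩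
  (countBelow p n + indicator (p n)) + (countBelow q n + indicator (q n))
    ≡⟨ cong₂ _+_ (countBelow-suc p n) (countBelow-suc q n) ⟨
  countBelow p (suc n) + countBelow q (suc n)                     ∎
  where
  open ≤-Reasoning
  p∨q = λ x → p x ∨ q x

countBelow-full : ∀ p c d → (∀ x → c ≤ x → x < c + d → T (p x)) →
                  countBelow p (c + d) ≡ countBelow p c + d
countBelow-full p c zero    _    = trans (cong (countBelow p) (+-identityʳ c)) (sym (+-identityʳ _))
countBelow-full p c (suc d) full = begin
  countBelow p (c + suc d)                       ≡⟨ cong (countBelow p) (+-suc c d) ⟩
  countBelow p (suc (c + d))                     ≡⟨ countBelow-suc p (c + d) ⟩
  countBelow p (c + d) + indicator (p (c + d))   ≡⟨ cong₂ _+_ (countBelow-full p c d full-below) (cong indicator p[c+d]) ⟩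
  countBelow p c + d + 1                         ≡⟨ +-comm _ 1 ⟩
  suc (countBelow p c + d)                       ≡⟨ +-suc (countBelow p c) d ⟨
  countBelow p c + suc d                         ∎
  where
  open ≡-Reasoning
  c+d<c+suc-d : c + d < c + suc d
  c+d<c+suc-d = +-monoʳ-< c (n<1+n d)
  full-below : ∀ x → c ≤ x → x < c + d → T (p x)
  full-below x c≤x x<c+d = full x c≤x (<-trans x<c+d c+d<c+suc-d)
  p[c+d] : p (c + d) ≡ true
  p[c+d] with p (c + d) | full (c + d) (m≤m+n c d) c+d<c+suc-d
  ... | true | _ = refl

countBelow-shiftBy-≤ : ∀ g p n → countBelow (shiftBy g p) n ≤ countBelow p n
countBelow-shiftBy-≤ g p n = begin
  countBelow (shiftBy g p) n        ≤⟨ countBelow-mono (shiftBy g p) (m≤n+m n g) ⟩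
  countBelow (shiftBy g p) (g + n)  ≡⟨ countBelow-shiftBy-+ n ⟩
  countBelow p n                    ∎
  where
  open ≤-Reasoning
  countBelow-shiftBy-≤g : ∀ m → m ≤ g → countBelow (shiftBy g p) m ≡ 0
  countBelow-shiftBy-≤g zero    _     = refl
  countBelow-shiftBy-≤g (suc m) 1+m≤g = trans (countBelow-suc (shiftBy g p) m)
    (cong₂ _+_ (countBelow-shiftBy-≤g m (<⇒≤ 1+m≤g)) (cong indicator (shiftBy-< g p 1+m≤g)))
  countBelow-shiftBy-+ : ∀ m → countBelow (shiftBy g p) (g + m) ≡ countBelow p m
  countBelow-shiftBy-+ zero    = trans (cong (countBelow (shiftBy g p)) (+-identityʳ g)) (countBelow-shiftBy-≤g g ≤-refl)
  countBelow-shiftBy-+ (suc m) = begin-equality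
    countBelow (shiftBy g p) (g + suc m)                                ≡⟨ cong (countBelow (shiftBy g p)) (+-suc g m) ⟩
    countBelow (shiftBy g p) (suc (g + m))                              ≡⟨ countBelow-suc (shiftBy g p) (g + m) ⟩
    countBelow (shiftBy g p) (g + m) + indicator (shiftBy g p (g + m))  ≡⟨ cong₂ _+_ (countBelow-shiftBy-+ m) (cong indicator (shiftBy-+ g p m)) ⟩
    countBelow p m + indicator (p m)                                    ≡⟨ countBelow-suc p m ⟨
    countBelow p (suc m)                                                ∎

m≤2a⇒a+d≤2b⇒m+d≤4b : ∀ {m a d b} → m ≤ 2 * a → a + d ≤ 2 * b → m + d ≤ 4 * b
m≤2a⇒a+d≤2b⇒m+d≤4b {m} {a} {d} {b} m≤2a a+d≤2b = begin
  m + d          ≤⟨ +-monoˡ-≤ d m≤2a ⟩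
  2 * a + d      ≤⟨ +-monoʳ-≤ (2 * a) (m≤n*m d 2) ⟩
  2 * a + 2 * d  ≡⟨ *-distribˡ-+ 2 a d ⟨
  2 * (a + d)    ≤⟨ *-monoʳ-≤ 2 a+d≤2b ⟩
  2 * (2 * b)    ≡⟨ *-assoc 2 2 b ⟨
  4 * b          ∎
  where open ≤-Reasoning

cΔ≤cΓ : ∀ Γ g → cΔ Γ g ≤ cΓ Γ
cΔ≤cΓ Γ g = condBelow-antimono {mem Γ} {memΔ Γ g}
  (λ x x∈Γ → Equivalence.from T-∨ (inj₁ x∈Γ)) (bound Γ)

cΔ+[cΓ∸cΔ]≡cΓ : ∀ Γ g → cΔ Γ g + (cΓ Γ ∸ cΔ Γ g) ≡ cΓ Γ
cΔ+[cΓ∸cΔ]≡cΓ Γ g = m+[n∸m]≡n (cΔ≤cΓ Γ g)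

countBelowΔ-cΓ : ∀ Γ g → countBelow (memΔ Γ g) (cΓ Γ) ≡ δΔ Γ g + (cΓ Γ ∸ cΔ Γ g)
countBelowΔ-cΓ Γ g = begin
  countBelow (memΔ Γ g) (cΓ Γ)                   ≡⟨ cong (countBelow (memΔ Γ g)) (cΔ+[cΓ∸cΔ]≡cΓ Γ g) ⟨
  countBelow (memΔ Γ g) (cΔ Γ g + (cΓ Γ ∸ cΔ Γ g)) ≡⟨ countBelow-full (memΔ Γ g) (cΔ Γ g) (cΓ Γ ∸ cΔ Γ g) above-cΔ ⟩
  δΔ Γ g + (cΓ Γ ∸ cΔ Γ g)                       ∎
  where
  open ≡-Reasoning
  cΔ+[cΓ∸cΔ]≤bound : cΔ Γ g + (cΓ Γ ∸ cΔ Γ g) ≤ bound Γ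
  cΔ+[cΓ∸cΔ]≤bound = ≤-trans (≤-reflexive (cΔ+[cΓ∸cΔ]≡cΓ Γ g)) (condBelow-≤ (mem Γ) (bound Γ))
  above-cΔ : ∀ x → cΔ Γ g ≤ x → x < cΔ Γ g + (cΓ Γ ∸ cΔ Γ g) → T (memΔ Γ g x)
  above-cΔ x cΔ≤x x<cΓ = condBelow-≤⇒T (memΔ Γ g) (bound Γ) cΔ≤x (<-≤-trans x<cΓ cΔ+[cΓ∸cΔ]≤bound)

countBelowΔ≤2*countBelowΓ : ∀ Γ g n → countBelow (memΔ Γ g) n ≤ 2 * countBelow (mem Γ) n
countBelowΔ≤2*countBelowΓ Γ g n = begin
  countBelow (memΔ Γ g) n                                ≤⟨ countBelow-∨ (mem Γ) (shiftBy g (mem Γ)) n ⟩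
  countBelow (mem Γ) n + countBelow (shiftBy g (mem Γ)) n ≤⟨ +-monoʳ-≤ (countBelow (mem Γ) n) (countBelow-shiftBy-≤ g (mem Γ) n) ⟩
  countBelow (mem Γ) n + countBelow (mem Γ) n            ≡⟨ cong (λ k → countBelow (mem Γ) n + k) (+-identityʳ _) ⟨
  2 * countBelow (mem Γ) n                               ∎
  where open ≤-Reasoning

cΓ≤4*δΓ : ∀ Γ g → + 0 ℤ.≤ Wgap Γ g → cΓ Γ ≤ 4 * δΓ Γ
cΓ≤4*δΓ Γ g W≥0 = begin
  cΓ Γ                          ≡⟨ cΔ+[cΓ∸cΔ]≡cΓ Γ g ⟨
  cΔ Γ g + (cΓ Γ ∸ cΔ Γ g)      ≤⟨ m≤2a⇒a+d≤2b⇒m+d≤4b {b = δΓ Γ} cΔ≤2*δΔ δΔ+[cΓ∸cΔ]≤2*δΓ ⟩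
  4 * δΓ Γ                      ∎
  where
  open ≤-Reasoning
  cΔ≤2*δΔ : cΔ Γ g ≤ 2 * δΔ Γ g
  cΔ≤2*δΔ = drop‿+≤+ (0≤i-j⇒j≤i W≥0)
  δΔ+[cΓ∸cΔ]≤2*δΓ : δΔ Γ g + (cΓ Γ ∸ cΔ Γ g) ≤ 2 * δΓ Γ
  δΔ+[cΓ∸cΔ]≤2*δΓ = subst (_≤ 2 * δΓ Γ) (countBelowΔ-cΓ Γ g) (countBelowΔ≤2*countBelowΓ Γ g (cΓ Γ))

cΓ≤k*δΓ : ∀ Γ g k → + 0 ℤ.≤ Wgap Γ g → 4 ≤ k → cΓ Γ ≤ k * δΓ Γ
cΓ≤k*δΓ Γ g k W≥0 4≤k = ≤-trans (cΓ≤4*δΓ Γ g W≥0) (*-monoˡ-≤ (δΓ Γ) 4≤k)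

corollary4p7 : (Γ : NumericalSemigroup) (e : ℕ) → HasEmbDim Γ e → 4 ≤ e →
    (Σ ℕ λ g → ¬ (g ∈Γ Γ) × + 0 ℤ.≤ Wgap Γ g) →
    ((k : ℕ) → 4 ≤ k → + 0 ℤ.≤ WΓ Γ k) × (cΓ Γ ≤ e * δΓ Γ)
corollary4p7 Γ e _ 4≤e (g , _ , W≥0) =
  (λ k 4≤k → i≤j⇒0≤j-i (ℤ.+≤+ (cΓ≤k*δΓ Γ g k W≥0 4≤k))) , cΓ≤k*δΓ Γ g e W≥0 4≤e
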